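{- Let $(X,A,m,\alpha)$ be a micro-macro system and let $(A,\to)$ be its directed graph of reproducible transitions. Then $(A,\to)$ is a disjoint union of directed cycles (including possibly loops $a\to a$) and rooted trees, with all edges of each tree directed towards its root (a macrostate with no outgoing edge). The entropy $S$ is constant on each cycle, and entropy increases (i.e. $S(a)\le S(b)$ for every edge $a\to b$) along paths towards the roots.
   Context: A micro-macro system $(X,A,m,\alpha)$ consists of finite sets $X$ and $A$, a bijection $\alpha:X\to X$ and a surjection $m:X\to A$; a macrostate $a$ is identified with the subset $m^{ -1}(a)\subseteq X$ and $|a|=|m^{ -1}(a)|$, $S(a)=\ln|a|$. A transition $a\to b$ between macrostates is reproducible if $\alpha(a)\subseteq b$, i.e. $\alpha(i)\in b$ for all $i\in a$. The graph $(A,\to)$ has vertex set $A$ and an edge $a\to b$ for each reproducible transition. -}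

module Defs where

open import Data.Nat using (ℕ; suc)
open import Data.Fin using (Fin; _≟_)
open import Data.List using (length; filter; allFin)
open import Data.Sum using (_⊎_)
open import Data.Product using (Σ; ∃; _×_)
open import Relation.Binary.PropositionalEquality using (_≡_)
open import Relation.Nullary using (¬_)
open import Function.Definitions using (Bijective; Surjective)

record MicroMacro (n k : ℕ) : Set where
  field
    m : Fin n → Fin k
    α : Fin n → Fin n
    m-surjective : Surjective _≡_ _≡_ m
    α-bijective  : Bijective _≡_ _≡_ α

module _ {n k : ℕ} (sys : MicroMacro n k) where
  open MicroMacro sys

  -- |a| = |m⁻¹(a)|, the number of microstates in macrostate a.
  -- (S(a) = ln |a|; since ln is strictly increasing, statements about S
  --  are expressed via |a|.)
  size : Fin k → ℕ
  size a = length (filter (λ x → m x ≟ a) (allFin n))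

  Edge : Fin k → Fin k → Set
  Edge a b = ∀ (x : Fin n) → m x ≡ a → m (α x) ≡ b

  data Walk : ℕ → Fin k → Fin k → Set where
    stay : ∀ {a} → Walk 0 a a
    step : ∀ {l a b c} → Edge a b → Walk l b c → Walk (suc l) a c

  Reach : Fin k → Fin k → Set
  Reach a b = ∃ λ l → Walk l a b

  OnCycle : Fin k → Set
  OnCycle a = ∃ λ l → Walk (suc l) a a

  Root : Fin k → Set
  Root r = ∀ b → ¬ Edge r b

  -- (A, →) is a disjoint union of directed cycles and rooted trees whose
  -- edges point towards the root:
  --  * every vertex has at most one outgoing edge;
  --  * every vertex lies on a cycle or has a directed path to a root;
  --  * a vertex on a cycle has exactly one incoming edge (the cycle edge),
  --    so no tree hangs onto a cycle.
  record CyclesAndRootedTrees : Set where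
    field
      out-unique : ∀ a b c → Edge a b → Edge a c → b ≡ c
      cycle-or-tree : ∀ a → OnCycle a ⊎ (Σ (Fin k) λ r → Root r × Reach a r)
      cycle-in-unique : ∀ a b c → OnCycle a → Edge b a → Edge c a → b ≡ c

{-# OPTIONS --safe #-}
-- Since α is injective, an edge a → b maps the microstates of a injectively
-- into b, so |a| ≤ |b|; two distinct macrostates with edges into the same b
-- even give |a| + |a′| ≤ |b|. Surjectivity of m makes every macrostate
-- nonempty, so a has at most one successor, namely m (α x) for any x ∈ a.
-- Sizes cannot grow around a cycle, hence are constant on it, and a cycle
-- vertex has no predecessor besides its cycle predecessor, as that would make
-- it strictly larger than the latter. Following successors from any vertex
-- for k steps either meets a root or, by pigeonhole, revisits a vertex; in the
-- latter case the starting vertex lies on that cycle, since walking backwards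
-- from a cycle never leaves it.
module Submission where

open import Defs
open import Data.Nat using (ℕ; zero; suc; _+_; _≤_; _<_; z≤n; s≤s)
open import Data.Nat.GeneralisedArithmetic using (iterate)
open import Data.Nat.Properties
  using (≤-refl; ≤-trans; ≤-antisym; <-irrefl; +-monoˡ-<; +-suc; n<1+n; m≤n⇒∃[o]m+o≡n; module ≤-Reasoning)
open import Data.Fin using (Fin; _≟_; toℕ)
open import Data.Fin.Properties using (all?; pigeonhole)
open import Data.List using (List; []; _∷_; length; filter; allFin; map; _++_)
open import Data.List.Properties using (length-map; length-++; length-removeAt′)
open import Data.List.Relation.Unary.Any using (here; there; index; _─_)
open import Data.List.Relation.Unary.All as All using ()
open import Data.List.Relation.Unary.AllPairs using (_∷_)
open import Data.List.Relation.Unary.Unique.Propositional using (Unique)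
open import Data.List.Relation.Unary.Unique.Propositional.Properties using (map⁺; filter⁺; ++⁺; allFin⁺)
open import Data.List.Relation.Binary.Disjoint.Propositional using (Disjoint)
open import Data.List.Relation.Binary.Subset.Propositional using (_⊆_)
open import Data.List.Membership.Propositional using (_∈_)
open import Data.List.Membership.Propositional.Properties
  using (∈-filter⁺; ∈-filter⁻; ∈-allFin; ∈-map⁻; ∈-++⁻; ∈-length)
open import Data.Product using (Σ-syntax; _×_; _,_; proj₁; proj₂)
open import Data.Sum using (_⊎_; inj₁; inj₂; [_,_]′)
open import Relation.Binary.PropositionalEquality using (_≡_; _≢_; refl; sym; trans; cong; subst)
open import Relation.Nullary using (yes; no; contradiction)
open import Relation.Nullary.Decidable using (_→-dec_)

module _ {A : Set} where

  ∈-─ : ∀ {x y : A} {ys} (x∈ys : x ∈ ys) → y ∈ ys → y ≢ x → y ∈ (ys ─ x∈ys)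
  ∈-─ (here refl) (here refl) y≢x = contradiction refl y≢x
  ∈-─ (here _)    (there y∈ys) _  = y∈ys
  ∈-─ (there _)   (here y≡z)   _  = here y≡z
  ∈-─ (there x∈ys) (there y∈ys) y≢x = there (∈-─ x∈ys y∈ys y≢x)

  Unique-⊆⇒length-≤ : ∀ {xs ys : List A} → Unique xs → xs ⊆ ys → length xs ≤ length ys
  Unique-⊆⇒length-≤ {[]}     _              _     = z≤n
  Unique-⊆⇒length-≤ {x ∷ xs} {ys} (x∉xs ∷ u) x∷xs⊆ys = begin
    suc (length xs)          ≤⟨ s≤s (Unique-⊆⇒length-≤ u xs⊆ys─x) ⟩
    suc (length (ys ─ x∈ys)) ≡⟨ sym (length-removeAt′ ys (index x∈ys)) ⟩
    length ys                ∎
    where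
    open ≤-Reasoning
    x∈ys : x ∈ ys
    x∈ys = x∷xs⊆ys (here refl)
    xs⊆ys─x : xs ⊆ (ys ─ x∈ys)
    xs⊆ys─x y∈xs = ∈-─ x∈ys (x∷xs⊆ys (there y∈xs)) (λ y≡x → All.lookup x∉xs y∈xs (sym y≡x))

iterate-+ : ∀ {A : Set} (f : A → A) x p q → iterate f x (p + q) ≡ iterate f (iterate f x p) q
iterate-+ f x zero    q = refl
iterate-+ f x (suc p) q = iterate-+ f (f x) p q

module _ {n k : ℕ} (sys : MicroMacro n k) where
  open MicroMacro sys

  private
    _⟶_ : Fin k → Fin k → Set
    a ⟶ b = Edge sys a b

    ∣_∣ : Fin k → ℕ
    ∣ a ∣ = size sys a

  preimage : Fin k → List (Fin n)
  preimage a = filter (λ x → m x ≟ a) (allFin n)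

  preimage-Unique : ∀ a → Unique (preimage a)
  preimage-Unique a = filter⁺ (λ x → m x ≟ a) (allFin⁺ n)

  ∈-preimage⁺ : ∀ {x a} → m x ≡ a → x ∈ preimage a
  ∈-preimage⁺ {x} mx≡a = ∈-filter⁺ (λ y → m y ≟ _) (∈-allFin x) mx≡a

  ∈-preimage⁻ : ∀ {x a} → x ∈ preimage a → m x ≡ a
  ∈-preimage⁻ {a = a} x∈ = proj₂ (∈-filter⁻ (λ y → m y ≟ a) {xs = allFin n} x∈)

  representative : Fin k → Fin n
  representative a = proj₁ (m-surjective a)

  m-representative : ∀ a → m (representative a) ≡ a
  m-representative a = proj₂ (m-surjective a) refl

  size-positive : ∀ a → 0 < ∣ a ∣
  size-positive a = ∈-length (∈-preimage⁺ (m-representative a))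

  successor : Fin k → Fin k
  successor a = m (α (representative a))

  ⟶⇒≡successor : ∀ {a b} → a ⟶ b → b ≡ successor a
  ⟶⇒≡successor a⟶b = sym (a⟶b _ (m-representative _))

  ⟶-functional : ∀ {a b c} → a ⟶ b → a ⟶ c → b ≡ c
  ⟶-functional a⟶b a⟶c = trans (⟶⇒≡successor a⟶b) (sym (⟶⇒≡successor a⟶c))

  Root⊎⟶successor : ∀ a → Root sys a ⊎ a ⟶ successor a
  Root⊎⟶successor a with all? (λ x → (m x ≟ a) →-dec (m (α x) ≟ successor a))
  ... | yes a⟶s = inj₂ a⟶s
  ... | no ¬a⟶s = inj₁ λ b a⟶b → ¬a⟶s (subst (a ⟶_) (⟶⇒≡successor a⟶b) a⟶b)

  length≤size : ∀ {xs b} → Unique xs → (∀ {x} → x ∈ xs → m (α x) ≡ b) → length xs ≤ ∣ b ∣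
  length≤size {xs} {b} u α[xs]⊆b = begin
    length xs         ≡⟨ sym (length-map α xs) ⟩
    length (map α xs) ≤⟨ Unique-⊆⇒length-≤ (map⁺ (proj₁ α-bijective) u) α[xs]⊆preimage ⟩
    ∣ b ∣             ∎
    where
    open ≤-Reasoning
    α[xs]⊆preimage : map α xs ⊆ preimage b
    α[xs]⊆preimage y∈ with _ , x∈xs , refl ← ∈-map⁻ α y∈ = ∈-preimage⁺ (α[xs]⊆b x∈xs)

  ⟶⇒size-≤ : ∀ {a b} → a ⟶ b → ∣ a ∣ ≤ ∣ b ∣
  ⟶⇒size-≤ {a} a⟶b = length≤size (preimage-Unique a) (λ x∈ → a⟶b _ (∈-preimage⁻ x∈))

  Walk⇒size-≤ : ∀ {l a b} → Walk sys l a b → ∣ a ∣ ≤ ∣ b ∣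
  Walk⇒size-≤ stay           = ≤-refl
  Walk⇒size-≤ (step a⟶b w) = ≤-trans (⟶⇒size-≤ a⟶b) (Walk⇒size-≤ w)

  ⟶-merge⇒size-+-≤ : ∀ {a b c} → b ≢ c → b ⟶ a → c ⟶ a → ∣ b ∣ + ∣ c ∣ ≤ ∣ a ∣
  ⟶-merge⇒size-+-≤ {a} {b} {c} b≢c b⟶a c⟶a = begin
    ∣ b ∣ + ∣ c ∣                       ≡⟨ sym (length-++ (preimage b)) ⟩
    length (preimage b ++ preimage c) ≤⟨ length≤size unique into-a ⟩
    ∣ a ∣                               ∎
    where
    open ≤-Reasoning
    disjoint : Disjoint (preimage b) (preimage c)
    disjoint (x∈b , x∈c) = b≢c (trans (sym (∈-preimage⁻ x∈b)) (∈-preimage⁻ x∈c))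
    unique : Unique (preimage b ++ preimage c)
    unique = ++⁺ (preimage-Unique b) (preimage-Unique c) disjoint
    into-a : ∀ {x} → x ∈ preimage b ++ preimage c → m (α x) ≡ a
    into-a x∈ = [ (λ x∈b → b⟶a _ (∈-preimage⁻ x∈b)) , (λ x∈c → c⟶a _ (∈-preimage⁻ x∈c)) ]′
                (∈-++⁻ (preimage b) x∈)

  sole-predecessor : ∀ {a b c} → c ⟶ a → ∣ a ∣ ≤ ∣ c ∣ → b ⟶ a → b ≡ c
  sole-predecessor {a} {b} {c} c⟶a ∣a∣≤∣c∣ b⟶a with b ≟ c
  ... | yes b≡c = b≡c
  ... | no b≢c = contradiction ∣c∣<∣c∣ (<-irrefl refl)
    where
    open ≤-Reasoning
    ∣c∣<∣c∣ : ∣ c ∣ < ∣ c ∣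
    ∣c∣<∣c∣ = begin-strict
      ∣ c ∣         <⟨ +-monoˡ-< ∣ c ∣ (size-positive b) ⟩
      ∣ b ∣ + ∣ c ∣ ≤⟨ ⟶-merge⇒size-+-≤ b≢c b⟶a c⟶a ⟩
      ∣ a ∣         ≤⟨ ∣a∣≤∣c∣ ⟩
      ∣ c ∣         ∎

  _++ʷ_ : ∀ {l l′ a b c} → Walk sys l a b → Walk sys l′ b c → Walk sys (l + l′) a c
  stay         ++ʷ w′ = w′
  step a⟶b w ++ʷ w′ = step a⟶b (w ++ʷ w′)

  _∷ʳʷ_ : ∀ {l a b c} → Walk sys l a b → b ⟶ c → Walk sys (suc l) a c
  stay         ∷ʳʷ b⟶c = step b⟶c stay
  step a⟶d w ∷ʳʷ b⟶c = step a⟶d (w ∷ʳʷ b⟶c)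

  unsnoc : ∀ {l a c} → Walk sys (suc l) a c → Σ[ b ∈ Fin k ] Walk sys l a b × b ⟶ c
  unsnoc (step a⟶c stay)          = _ , stay , a⟶c
  unsnoc (step a⟶d (step d⟶e w))
    with b , w′ , b⟶c ← unsnoc (step d⟶e w) = b , step a⟶d w′ , b⟶c

  OnCycle-⟶-return : ∀ {a b} → OnCycle sys a → a ⟶ b → Reach sys b a
  OnCycle-⟶-return (l , step a⟶c w) a⟶b with refl ← ⟶-functional a⟶c a⟶b = l , w

  OnCycle-⟶ : ∀ {a b} → OnCycle sys a → a ⟶ b → OnCycle sys b
  OnCycle-⟶ cycle a⟶b with l , w ← OnCycle-⟶-return cycle a⟶b = l , w ∷ʳʷ a⟶b

  OnCycle-⟶⇒size-≡ : ∀ {a b} → OnCycle sys a → a ⟶ b → ∣ a ∣ ≡ ∣ b ∣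
  OnCycle-⟶⇒size-≡ cycle a⟶b =
    ≤-antisym (⟶⇒size-≤ a⟶b) (Walk⇒size-≤ (proj₂ (OnCycle-⟶-return cycle a⟶b)))

  OnCycle-Walk⇒size-≡ : ∀ {l a b} → OnCycle sys a → Walk sys l a b → ∣ a ∣ ≡ ∣ b ∣
  OnCycle-Walk⇒size-≡ cycle stay           = refl
  OnCycle-Walk⇒size-≡ cycle (step a⟶c w) =
    trans (OnCycle-⟶⇒size-≡ cycle a⟶c) (OnCycle-Walk⇒size-≡ (OnCycle-⟶ cycle a⟶c) w)

  -- Sizes do not decrease along the cycle, so by sole-predecessor b is the
  -- last vertex of the cycle before a.
  ⟶-OnCycle⇒Reach : ∀ {a b} → OnCycle sys a → b ⟶ a → Reach sys a b
  ⟶-OnCycle⇒Reach (l , w) b⟶a with d , w′ , d⟶a ← unsnoc w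
    with refl ← sole-predecessor d⟶a (Walk⇒size-≤ w′) b⟶a = l , w′

  OnCycle-in-unique : ∀ a b c → OnCycle sys a → b ⟶ a → c ⟶ a → b ≡ c
  OnCycle-in-unique a b c cycle b⟶a c⟶a =
    sym (sole-predecessor b⟶a (Walk⇒size-≤ (proj₂ (⟶-OnCycle⇒Reach cycle b⟶a))) c⟶a)

  Walk-OnCycle : ∀ {l a b} → Walk sys l a b → OnCycle sys b → OnCycle sys a
  Walk-OnCycle stay           cycle = cycle
  Walk-OnCycle (step a⟶c w) cycle with l , c⇝a ← ⟶-OnCycle⇒Reach (Walk-OnCycle w cycle) a⟶c =
    l , step a⟶c c⇝a

  ReachesRoot : Fin k → Set
  ReachesRoot a = Σ[ r ∈ Fin k ] Root sys r × Reach sys a r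

  Walk⊎ReachesRoot : ∀ t a → Walk sys t a (iterate successor a t) ⊎ ReachesRoot a
  Walk⊎ReachesRoot zero    a = inj₁ stay
  Walk⊎ReachesRoot (suc t) a with Root⊎⟶successor a
  ... | inj₁ root = inj₂ (a , root , 0 , stay)
  ... | inj₂ a⟶s with Walk⊎ReachesRoot t (successor a)
  ...   | inj₁ w                   = inj₁ (step a⟶s w)
  ...   | inj₂ (r , root , l , w) = inj₂ (r , root , suc l , step a⟶s w)

  revisit⇒OnCycle⊎ReachesRoot : ∀ a i o →
    iterate successor a i ≡ iterate successor a (i + suc o) → OnCycle sys a ⊎ ReachesRoot a
  revisit⇒OnCycle⊎ReachesRoot a i o revisit
    with Walk⊎ReachesRoot i a | Walk⊎ReachesRoot (suc o) (iterate successor a i)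
  ... | inj₂ reaches | _                         = inj₂ reaches
  ... | inj₁ w       | inj₂ (r , root , l , w′) = inj₂ (r , root , _ , w ++ʷ w′)
  ... | inj₁ w       | inj₁ loop                 =
    inj₁ (Walk-OnCycle w (o , subst (Walk sys (suc o) _) loop-closes loop))
    where
    loop-closes : iterate successor (iterate successor a i) (suc o) ≡ iterate successor a i
    loop-closes = sym (trans revisit (iterate-+ successor a i (suc o)))

  OnCycle⊎ReachesRoot : ∀ a → OnCycle sys a ⊎ ReachesRoot a
  OnCycle⊎ReachesRoot a
    with i , j , i<j , revisit ← pigeonhole (n<1+n k) (λ (i : Fin (suc k)) → iterate successor a (toℕ i))
    with o , i+1+o≡j ← m≤n⇒∃[o]m+o≡n i<j
    = revisit⇒OnCycle⊎ReachesRoot a (toℕ i) o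
        (trans revisit (cong (iterate successor a) (sym (trans (+-suc (toℕ i) o) i+1+o≡j))))

  cyclesAndRootedTrees : CyclesAndRootedTrees sys
  cyclesAndRootedTrees = record
    { out-unique      = λ a b c → ⟶-functional
    ; cycle-or-tree   = OnCycle⊎ReachesRoot
    ; cycle-in-unique = OnCycle-in-unique
    }

theorem10 : ∀ {n k : ℕ} (sys : MicroMacro n k) →
    CyclesAndRootedTrees sys
    × (∀ (a b : Fin k) → OnCycle sys a → Reach sys a b → size sys a ≡ size sys b)
    × (∀ (a b : Fin k) → Edge sys a b → size sys a ≤ size sys b)
theorem10 sys =
  cyclesAndRootedTrees sys ,
  (λ a b cycle (_ , w) → OnCycle-Walk⇒size-≡ sys cycle w) ,
  (λ a b → ⟶⇒size-≤ sys)
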